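{- Let $\ell$ be a positive integer, let $P$ be a path with endvertices $u,v$ in a graph $G$, and let $(Q_1,\ldots,Q_r)$ be a tuple of $P$-paths, where $Q_i$ has endvertices $u_i<_P v_i$, satisfying: (E1$'$) if $|i-j|>1$ then $Q_i$ and $Q_j$ are internally disjoint; (E2) the cycle $u_iPv_i\cup Q_i$ is short for each $i$; (E3) $u_1=u$ and $v_r=v$; (E4) $u_i<_P u_{i+1}<_P v_i<_P v_{i+1}$ for $i=1,\ldots,r-1$. If every long cycle in $G$ has length at least $2\ell$, then there is a short path between $u$ and $v$ that is contained in $P\cup\bigcup_{j=1}^r Q_j$.
   Context: A cycle or path is short if its length (number of edges) is less than $\ell$, and long if its length is at least $\ell$. For a path $P$ with endvertices $u,v$, $\le_P$ is the total order on $V(P)$ given by distance from $u$ along $P$, and $xPy$ denotes the subpath of $P$ between $x,y\in V(P)$. For a subgraph $H$, an $H$-path is a path with two distinct endvertices in $H$ that is internally disjoint from $H$ (a path of length $1$ between two vertices of $H$ counts only if its edge is not in $E(H)$). -}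

module Defs where

open import Data.Nat using (ℕ; zero; suc; _+_; _*_; _∸_; _<_; _≤_)
open import Data.Fin using (Fin; zero; suc; toℕ; inject₁; fromℕ)
open import Data.Product using (Σ; ∃; _×_; _,_)
open import Data.Sum using (_⊎_)
open import Relation.Nullary using (¬_; Dec)
open import Relation.Binary.PropositionalEquality using (_≡_; _≢_)
open import Function.Definitions using (Injective)
open import Level using (0ℓ)

record Graph (n : ℕ) : Set₁ where
  field
    Adj    : Fin n → Fin n → Set
    adj?   : ∀ x y → Dec (Adj x y)
    sym    : ∀ {x y} → Adj x y → Adj y x
    irrefl : ∀ {x} → ¬ Adj x x
open Graph public

record Path {n : ℕ} (G : Graph n) : Set where
  field
    len : ℕ
    vtx : Fin (suc len) → Fin n
    inj : Injective _≡_ _≡_ vtx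
    adj : ∀ (i : Fin len) → Adj G (vtx (inject₁ i)) (vtx (suc i))
open Path public

start : ∀ {n} {G : Graph n} → Path G → Fin n
start P = vtx P zero

end : ∀ {n} {G : Graph n} → Path G → Fin n
end P = vtx P (fromℕ (len P))

VertexOf : ∀ {n} {G : Graph n} → Path G → Fin n → Set
VertexOf P x = ∃ λ i → vtx P i ≡ x

EdgeOf : ∀ {n} {G : Graph n} → Path G → Fin n → Fin n → Set
EdgeOf P x y = ∃ λ (i : Fin (len P)) →
  (vtx P (inject₁ i) ≡ x × vtx P (suc i) ≡ y) ⊎ (vtx P (inject₁ i) ≡ y × vtx P (suc i) ≡ x)

InternalVertexOf : ∀ {n} {G : Graph n} → Path G → Fin n → Set
InternalVertexOf P x = ∃ λ i → 0 < toℕ i × toℕ i < len P × vtx P i ≡ x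

record Cycle {n : ℕ} (G : Graph n) : Set where
  field
    m    : ℕ
    cvtx : Fin (suc (suc (suc m))) → Fin n
    cinj : Injective _≡_ _≡_ cvtx
    cadj : ∀ (i : Fin (suc (suc m))) → Adj G (cvtx (inject₁ i)) (cvtx (suc i))
    wrap : Adj G (cvtx (fromℕ (suc (suc m)))) (cvtx zero)
open Cycle public

cycleLength : ∀ {n} {G : Graph n} → Cycle G → ℕ
cycleLength C = suc (suc (suc (m C)))

-- Q is a P-path: distinct endvertices in P (the endpoint conditions are stated
-- separately where P-paths are used), internally disjoint from P, and if Q is
-- a single edge, that edge is not an edge of P.
IsPPath : ∀ {n} {G : Graph n} → Path G → Path G → Set
IsPPath P Q =
  start Q ≢ end Q
  × VertexOf P (start Q) × VertexOf P (end Q)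
  × (∀ x → InternalVertexOf Q x → ¬ VertexOf P x)
  × (len Q ≡ 1 → ¬ EdgeOf P (start Q) (end Q))

InternallyDisjoint : ∀ {n} {G : Graph n} → Path G → Path G → Set
InternallyDisjoint Q R =
  (∀ x → InternalVertexOf Q x → ¬ VertexOf R x) × (∀ x → InternalVertexOf R x → ¬ VertexOf Q x)

-- Length of the cycle  xPy ∪ Q  where x = vtx P a, y = vtx P b, a < b, Q a P-path from x to y.
subpathCycleLength : ∀ {n} {G : Graph n} (P : Path G) → Fin (suc (len P)) → Fin (suc (len P)) → Path G → ℕ
subpathCycleLength P a b Q = (toℕ b ∸ toℕ a) + len Q

-- Induction on the number of P-paths. A single P-path Q 0 runs from u to v and closes the
-- short cycle uPv ∪ Q 0, so it is the required path. Otherwise Q 0 and Q 1 are replaced by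
-- one P-path:
--   * if Q 2 starts before Q 0 ends, Q 1 is redundant and is dropped;
--   * if Q 1 meets an inner vertex of Q 0, the two are spliced at the last such vertex of Q 1;
--   * otherwise P is rebased onto Q 0 ∪ v₀Pv, and uPu₁ ∪ Q 1 becomes the first P-path.
-- Each new cycle is shorter than the sum of two short cycles, hence shorter than 2ℓ, and so
-- it is short, as no cycle has length in [ℓ, 2ℓ). For the splice, one of the two is an
-- auxiliary cycle, formed by Q 1 beyond the splice point and the rebased path, which is
-- shown to be short first.

module Submission where

open import Defs
open import Data.Nat using (ℕ; zero; suc; _+_; _*_; _∸_; _<_; _≤_; z≤n; s≤s; _≤ᵇ_; _≤?_; _<?_)
open import Data.Nat.Properties
open import Data.Nat.Tactic.RingSolver using (solve)
open import Data.Fin using (Fin; zero; suc; toℕ; inject₁; fromℕ; fromℕ<) renaming (_≟_ to _≟ᶠ_)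
open import Data.Fin.Properties using (toℕ-injective; toℕ<n; toℕ-inject₁; toℕ-fromℕ; toℕ-fromℕ<)
open import Data.Product using (Σ; ∃; _×_; _,_; proj₁; proj₂)
open import Data.Sum using (_⊎_; inj₁; inj₂; [_,_]′)
open import Data.Bool using (true; false; T; if_then_else_)
open import Data.Empty using (⊥-elim)
open import Data.List using (_∷_; [])
open import Function using (_∘_)
open import Relation.Nullary using (¬_; Dec; yes; no; contradiction)
open import Relation.Nullary.Decidable using (_×-dec_)
open import Relation.Binary.PropositionalEquality
  using (_≡_; _≢_; refl; trans; cong; subst; subst₂; module ≡-Reasoning) renaming (sym to ≡-sym)

-- To prove X ≤ Y it suffices to find an identity X + B + s ≡ Y + A with A ≤ B;
-- such identities are discharged by the ring solver.
≤-by-identity : ∀ {X Y A B} → A ≤ B → ∀ s → X + B + s ≡ Y + A → X ≤ Y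
≤-by-identity {X} {Y} {A} {B} A≤B s eq = +-cancelʳ-≤ B X Y (begin
  X + B      ≤⟨ m≤m+n (X + B) s ⟩
  X + B + s  ≡⟨ eq ⟩
  Y + A      ≤⟨ +-monoʳ-≤ Y A≤B ⟩
  Y + B      ∎)
  where open ≤-Reasoning

2≤+ : ∀ d {x y} → 0 < x → 0 < y → 2 ≤ d + (x + y)
2≤+ d {x} {y} 0<x 0<y = ≤-trans (+-mono-≤ 0<x 0<y) (m≤n+m (x + y) d)

≤-or-beyond : ∀ a i → i ≤ a ⊎ ∃ λ j → i ≡ a + suc j
≤-or-beyond zero    zero    = inj₁ z≤n
≤-or-beyond zero    (suc i) = inj₂ (i , refl)
≤-or-beyond (suc a) zero    = inj₁ z≤n
≤-or-beyond (suc a) (suc i) with ≤-or-beyond a i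
... | inj₁ i≤a      = inj₁ (s≤s i≤a)
... | inj₂ (j , eq) = inj₂ (j , cong suc eq)

<-or-beyond : ∀ a i → i < a ⊎ ∃ λ j → i ≡ a + j
<-or-beyond zero    i       = inj₂ (i , refl)
<-or-beyond (suc a) zero    = inj₁ (s≤s z≤n)
<-or-beyond (suc a) (suc i) with <-or-beyond a i
... | inj₁ i<a      = inj₁ (s≤s i<a)
... | inj₂ (j , eq) = inj₂ (j , cong suc eq)

module _ {P : ℕ → Set} (P? : ∀ i → Dec (P i)) where

  last-below : ∀ N → (∀ i → i < N → ¬ P i) ⊎ ∃ λ i → i < N × P i × (∀ j → i < j → j < N → ¬ P j)
  last-below zero = inj₁ λ _ ()
  last-below (suc N) with P? N | last-below N
  ... | yes p  | _ = inj₂ (N , ≤-refl , p , λ j N<j j≤N _ → <⇒≱ N<j (≤-pred j≤N))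
  ... | no ¬p | inj₁ none =
    inj₁ λ i i≤N → [ none i , (λ { refl → ¬p }) ]′ (m<1+n⇒m<n∨m≡n i≤N)
  ... | no ¬p | inj₂ (i , i<N , p , none-after) =
    inj₂ (i , m<n⇒m<1+n i<N , p ,
          λ j i<j j≤N → [ none-after j i<j , (λ { refl → ¬p }) ]′ (m<1+n⇒m<n∨m≡n j≤N))

_⊲_ : ∀ {A : Set} → A → (ℕ → A) → ℕ → A
(x ⊲ g) zero    = x
(x ⊲ g) (suc i) = g (suc (suc i))

⊲-last : ∀ {A : Set} k {x : A} g {y} → (k ≡ 0 → x ≡ y) → g (suc k) ≡ y → (x ⊲ g) k ≡ y
⊲-last zero    _ x≡y _    = x≡y refl
⊲-last (suc k) _ _   g≡y = g≡y

detour-<2ℓ : ∀ ℓ s e c t r {L₀ pv₀ pv₁ L₁ pu₀ pu₁} →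
  suc s + e ≡ L₀ → suc pv₀ + c ≡ pv₁ → t + r ≡ L₁ → pu₀ ≡ 0 →
  pv₀ + L₀ < ℓ + pu₀ → pv₁ + L₁ < ℓ + pu₁ → pu₁ < pv₀ → suc (e + suc c) + r < 2 * ℓ
detour-<2ℓ ℓ s e c t r {pv₀ = pv₀} {pu₁ = pu₁} refl refl refl refl h₀ h₁ h =
  ≤-by-identity (+-mono-≤ h₀ (+-mono-≤ h₁ h)) (pv₀ + s + t + 2)
    (solve (ℓ ∷ s ∷ e ∷ pv₀ ∷ c ∷ r ∷ t ∷ pu₁ ∷ []))

merged-<2ℓ : ∀ ℓ s e pv₀ c r {L₀ pu₀} → suc s + e ≡ L₀ → pu₀ ≡ 0 →
  pv₀ + L₀ < ℓ + pu₀ → suc (e + suc c) + r < ℓ → suc (pv₀ + c) + (s + r) < 2 * ℓ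
merged-<2ℓ ℓ s e pv₀ c r refl refl h₀ h =
  ≤-by-identity (+-mono-≤ h₀ h) (e + e + 3) (solve (ℓ ∷ s ∷ e ∷ pv₀ ∷ c ∷ r ∷ []))

rerouted-<2ℓ : ∀ ℓ a c pu₁ L₁ {L₀ pv₀ pv₁ pu₀} → suc a ≡ L₀ → pv₀ + c ≡ pv₁ → pu₀ ≡ 0 →
  pv₀ + L₀ < ℓ + pu₀ → pv₁ + L₁ < ℓ + pu₁ → pu₁ < pv₀ → suc (a + c) + (pu₁ + L₁) < 2 * ℓ
rerouted-<2ℓ ℓ a c pu₁ L₁ {pv₀ = pv₀} refl refl refl h₀ h₁ h =
  ≤-by-identity (+-mono-≤ h₀ (+-mono-≤ h₁ (+-mono-≤ h h))) 3
    (solve (ℓ ∷ a ∷ pv₀ ∷ c ∷ L₁ ∷ pu₁ ∷ []))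

-- Positions x ≥ b of P reappear as b′ + (x ∸ b) on the rebased path.
short-shift : ∀ {ℓ b b′ p q L} → b ≤ p → b ≤ q → q + L < ℓ + p →
              b′ + (q ∸ b) + L < ℓ + (b′ + (p ∸ b))
short-shift {ℓ} {b} {b′} {p} {q} {L} b≤p b≤q h = rebase (p ∸ b) (q ∸ b)
  (subst₂ (λ x y → x + L < ℓ + y) (≡-sym (m+[n∸m]≡n b≤q)) (≡-sym (m+[n∸m]≡n b≤p)) h)
  where
  rebase : ∀ x y → b + y + L < ℓ + (b + x) → b′ + y + L < ℓ + (b′ + x)
  rebase x y h′ = ≤-by-identity h′ 0 (solve (ℓ ∷ b ∷ b′ ∷ x ∷ y ∷ L ∷ []))

module _ {n : ℕ} (G : Graph n) where

  -- Paths indexed by ℕ rather than by Fin, so that subpaths and concatenations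
  -- need no index casts; only the positions 0 … size are meaningful.
  record ℕPath : Set where
    field
      size   : ℕ
      at     : ℕ → Fin n
      at-inj : ∀ {i j} → i ≤ size → j ≤ size → at i ≡ at j → i ≡ j
      at-adj : ∀ {i} → i < size → Adj G (at i) (at (suc i))
  open ℕPath public

  Visits : ℕPath → Fin n → Set
  Visits P x = ∃ λ i → i ≤ size P × at P i ≡ x

  Visits? : ∀ P x → Dec (Visits P x)
  Visits? P x with last-below (λ i → at P i ≟ᶠ x) (suc (size P))
  ... | inj₁ none            = no λ (i , i≤ , eq) → none i (s≤s i≤) eq
  ... | inj₂ (i , i< , eq , _) = yes (i , ≤-pred i< , eq)

  InteriorAvoids : ℕPath → ℕPath → Set
  InteriorAvoids Q B = ∀ i → 0 < i → i < size Q → ¬ Visits B (at Q i)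

  InteriorsDisjoint : ℕPath → ℕPath → Set
  InteriorsDisjoint A B = InteriorAvoids A B × InteriorAvoids B A

  subpath : (P : ℕPath) (a m : ℕ) → a + m ≤ size P → ℕPath
  subpath P a m a+m≤ = record
    { size   = m
    ; at     = λ i → at P (a + i)
    ; at-inj = λ i≤ j≤ eq → +-cancelˡ-≡ a _ _ (at-inj P (bound i≤) (bound j≤) eq)
    ; at-adj = λ {i} i<m → subst (λ z → Adj G (at P (a + i)) (at P z)) (≡-sym (+-suc a i))
                 (at-adj P (subst (_≤ size P) (+-suc a i) (bound i<m))) }
    where
    bound : ∀ {i} → i ≤ m → a + i ≤ size P
    bound i≤m = ≤-trans (+-monoʳ-≤ a i≤m) a+m≤

  reverse : ℕPath → ℕPath
  reverse P = record
    { size   = size P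
    ; at     = λ i → at P (size P ∸ i)
    ; at-inj = λ {i} {j} i≤ j≤ eq →
        ∸-cancelˡ-≡ i≤ j≤ (at-inj P (m∸n≤m (size P) i) (m∸n≤m (size P) j) eq)
    ; at-adj = λ {i} i< → Graph.sym G
        (subst (λ z → Adj G (at P (size P ∸ suc i)) (at P z)) (≡-sym (+-∸-assoc 1 i<))
          (at-adj P (subst (_≤ size P) (+-∸-assoc 1 i<) (m∸n≤m (size P) i)))) }

  concat-at : ℕPath → ℕPath → ℕ → Fin n
  concat-at A B i = if i ≤ᵇ size A then at A i else at B (i ∸ size A)

  concat-at-left : ∀ A B {i} → i ≤ size A → concat-at A B i ≡ at A i
  concat-at-left A B {i} i≤ with i ≤ᵇ size A in eq
  ... | true  = refl
  ... | false = ⊥-elim (subst T eq (≤⇒≤ᵇ i≤))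

  concat-at-right : ∀ A B j → at A (size A) ≡ at B 0 → concat-at A B (size A + j) ≡ at B j
  concat-at-right A B zero joined =
    trans (concat-at-left A B (≤-reflexive (+-identityʳ _))) (trans (cong (at A) (+-identityʳ _)) joined)
  concat-at-right A B (suc j) _ with size A + suc j ≤ᵇ size A in eq
  ... | false = cong (at B) (m+n∸m≡n (size A) (suc j))
  ... | true  = ⊥-elim (<⇒≱ (m<m+n (size A) (s≤s z≤n)) (≤ᵇ⇒≤ _ _ (subst T (≡-sym eq) _)))

  DisjointBefore : ℕPath → ℕPath → Set
  DisjointBefore A B = ∀ {i j} → i < size A → j ≤ size B → at A i ≢ at B j

  concat : (A B : ℕPath) → at A (size A) ≡ at B 0 → DisjointBefore A B → ℕPath
  concat A B joined disjoint = record
    { size = size A + size B ; at = concat-at A B ; at-inj = injective ; at-adj = adjacent }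
    where
    left : ∀ {i} → i ≤ size A → concat-at A B i ≡ at A i
    left = concat-at-left A B
    right : ∀ j → concat-at A B (size A + j) ≡ at B j
    right j = concat-at-right A B j joined
    apart : ∀ {i j} → i ≤ size A → suc j ≤ size B → at A i ≢ at B (suc j)
    apart i≤ j< eq with m≤n⇒m<n∨m≡n i≤
    ... | inj₁ i<  = disjoint i< j< eq
    ... | inj₂ refl = 0≢1+n (at-inj B z≤n j< (trans (≡-sym joined) eq))
    injective : ∀ {i j} → i ≤ size A + size B → j ≤ size A + size B →
                concat-at A B i ≡ concat-at A B j → i ≡ j
    injective {i} {j} i≤ j≤ eq with ≤-or-beyond (size A) i | ≤-or-beyond (size A) j
    ... | inj₁ p | inj₁ q = at-inj A p q (trans (≡-sym (left p)) (trans eq (left q)))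
    ... | inj₁ p | inj₂ (j′ , refl) =
      ⊥-elim (apart p (+-cancelˡ-≤ (size A) _ _ j≤) (trans (≡-sym (left p)) (trans eq (right (suc j′)))))
    ... | inj₂ (i′ , refl) | inj₁ q =
      ⊥-elim (apart q (+-cancelˡ-≤ (size A) _ _ i≤) (trans (≡-sym (left q)) (trans (≡-sym eq) (right (suc i′)))))
    ... | inj₂ (i′ , refl) | inj₂ (j′ , refl) =
      cong (size A +_) (at-inj B (+-cancelˡ-≤ (size A) _ _ i≤) (+-cancelˡ-≤ (size A) _ _ j≤)
        (trans (≡-sym (right (suc i′))) (trans eq (right (suc j′)))))
    adjacent : ∀ {i} → i < size A + size B → Adj G (concat-at A B i) (concat-at A B (suc i))
    adjacent {i} i< with <-or-beyond (size A) i
    ... | inj₁ p = subst₂ (Adj G) (≡-sym (left (<⇒≤ p))) (≡-sym (left p)) (at-adj A p)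
    ... | inj₂ (j , refl) =
      subst (λ z → Adj G (concat-at A B (size A + j)) (concat-at A B z)) (+-suc (size A) j)
        (subst₂ (Adj G) (≡-sym (right j)) (≡-sym (right (suc j))) (at-adj B (+-cancelˡ-< (size A) _ _ i<)))

  close : (W : ℕPath) (m : ℕ) → size W ≡ suc (suc m) → Adj G (at W (size W)) (at W 0) → Cycle G
  close W m size≡ closing = record
    { m    = m
    ; cvtx = λ i → at W (toℕ i)
    ; cinj = λ {i} {j} eq → toℕ-injective (at-inj W (bound i) (bound j) eq)
    ; cadj = λ i → subst (λ z → Adj G (at W z) (at W (suc (toℕ i)))) (≡-sym (toℕ-inject₁ i))
                     (at-adj W (subst (suc (toℕ i) ≤_) (≡-sym size≡) (toℕ<n i)))
    ; wrap = subst (λ z → Adj G (at W z) (at W 0)) (trans size≡ (≡-sym (toℕ-fromℕ (suc (suc m))))) closing }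
    where
    bound : (i : Fin (suc (suc (suc m)))) → toℕ i ≤ size W
    bound i = subst (toℕ i ≤_) (≡-sym size≡) (≤-pred (toℕ<n i))

  Visits-subpath : ∀ P a m a+m≤ x → Visits (subpath P a m a+m≤) x → Visits P x
  Visits-subpath P a m a+m≤ x (i , i≤ , eq) = a + i , ≤-trans (+-monoʳ-≤ a i≤) a+m≤ , eq

  Visits-concat : ∀ A B joined (disjoint : DisjointBefore A B) x →
                  Visits (concat A B joined disjoint) x → Visits A x ⊎ Visits B x
  Visits-concat A B joined _ x (i , i≤ , eq) with ≤-or-beyond (size A) i
  ... | inj₁ p = inj₁ (i , p , trans (≡-sym (concat-at-left A B p)) eq)
  ... | inj₂ (j , refl) =
    inj₂ (suc j , +-cancelˡ-≤ (size A) _ _ i≤ , trans (≡-sym (concat-at-right A B (suc j) joined)) eq)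

  module Restricted (VS : Fin n → Set) (ES : Fin n → Fin n → Set) where

    Within : ℕPath → Set
    Within R = (∀ i → i ≤ size R → VS (at R i)) × (∀ i → i < size R → ES (at R i) (at R (suc i)))

    Within-subpath : ∀ P a m a+m≤ → Within P → Within (subpath P a m a+m≤)
    Within-subpath P a m a+m≤ (vs , es) =
      (λ i i≤ → vs (a + i) (≤-trans (+-monoʳ-≤ a i≤) a+m≤)) ,
      λ i i< → subst (λ z → ES (at P (a + i)) (at P z)) (≡-sym (+-suc a i))
                 (es (a + i) (≤-trans (subst (_≤ a + m) (+-suc a i) (+-monoʳ-≤ a i<)) a+m≤))

    Within-concat : ∀ A B joined (disjoint : DisjointBefore A B) →
                    Within A → Within B → Within (concat A B joined disjoint)
    Within-concat A B joined disjoint (vsA , esA) (vsB , esB) = vs , es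
      where
      vs : ∀ i → i ≤ size A + size B → VS (concat-at A B i)
      vs i i≤ with ≤-or-beyond (size A) i
      ... | inj₁ p = subst VS (≡-sym (concat-at-left A B p)) (vsA i p)
      ... | inj₂ (j , refl) =
        subst VS (≡-sym (concat-at-right A B (suc j) joined)) (vsB (suc j) (+-cancelˡ-≤ (size A) _ _ i≤))
      es : ∀ i → i < size A + size B → ES (concat-at A B i) (concat-at A B (suc i))
      es i i< with <-or-beyond (size A) i
      ... | inj₁ p = subst₂ ES (≡-sym (concat-at-left A B (<⇒≤ p))) (≡-sym (concat-at-left A B p)) (esA i p)
      ... | inj₂ (j , refl) =
        subst (λ z → ES (concat-at A B (size A + j)) (concat-at A B z)) (+-suc (size A) j)
          (subst₂ ES (≡-sym (concat-at-right A B j joined)) (≡-sym (concat-at-right A B (suc j) joined))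
            (esB j (+-cancelˡ-< (size A) _ _ i<)))

  module LongCycles (ℓ : ℕ) (long : ∀ (C : Cycle G) → ℓ ≤ cycleLength C → 2 * ℓ ≤ cycleLength C) where

    closed-short : (W : ℕPath) → 2 ≤ size W → Adj G (at W (size W)) (at W 0) →
                   suc (size W) < 2 * ℓ → suc (size W) < ℓ
    closed-short W 2≤ closing <2ℓ with ℓ ≤? suc (size W)
    ... | no ℓ≰ = ≰⇒> ℓ≰
    ... | yes ℓ≤ =
      ⊥-elim (<⇒≱ <2ℓ (subst (2 * ℓ ≤_) length≡ (long C (subst (ℓ ≤_) (≡-sym length≡) ℓ≤))))
      where
      size≡ : size W ≡ suc (suc (size W ∸ 2))
      size≡ = ≡-sym (m+[n∸m]≡n 2≤)
      C = close W (size W ∸ 2) size≡ closing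
      length≡ : cycleLength C ≡ suc (size W)
      length≡ = cong suc (≡-sym size≡)

    -- suc d + size Q is the length of the cycle formed by Q and B from position a to a + suc d.
    ear-short : (B Q : ℕPath) (a d : ℕ) → a + suc d ≤ size B →
                at Q 0 ≡ at B a → at Q (size Q) ≡ at B (a + suc d) → InteriorAvoids Q B →
                2 ≤ d + size Q → suc d + size Q < 2 * ℓ → suc d + size Q < ℓ
    ear-short B Q a d bound start≡ end≡ avoids 2≤ <2ℓ =
      subst (_< ℓ) length≡ (closed-short W 2≤′ closing (subst (_< 2 * ℓ) (≡-sym length≡) <2ℓ))
      where
      bound′ : suc a + d ≤ size B
      bound′ = subst (_≤ size B) (+-suc a d) bound
      back = reverse (subpath B (suc a) d bound′)
      joined : at Q (size Q) ≡ at back 0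
      joined = trans end≡ (cong (at B) (+-suc a d))
      a<size : a < size B
      a<size = ≤-trans (s≤s (m≤m+n a d)) bound′
      on-segment : ∀ j → suc a + (d ∸ j) ≤ size B
      on-segment j = ≤-trans (+-monoʳ-≤ (suc a) (m∸n≤m d j)) bound′
      disjoint : DisjointBefore Q back
      disjoint {zero} {j} _ _ eq =
        <⇒≢ (s≤s (m≤m+n a (d ∸ j))) (at-inj B (<⇒≤ a<size) (on-segment j) (trans (≡-sym start≡) eq))
      disjoint {suc i} {j} i< _ eq = avoids (suc i) (s≤s z≤n) i< (suc a + (d ∸ j) , on-segment j , ≡-sym eq)
      W = concat Q back joined disjoint
      2≤′ : 2 ≤ size Q + d
      2≤′ = subst (2 ≤_) (+-comm d (size Q)) 2≤
      length≡ : suc (size Q + d) ≡ suc d + size Q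
      length≡ = cong suc (+-comm (size Q) d)
      closing : Adj G (at W (size W)) (at W 0)
      closing = subst₂ (Adj G)
        (≡-sym (trans (concat-at-right Q back d joined)
                      (cong (at B) (trans (cong (suc a +_) (n∸n≡0 d)) (+-identityʳ (suc a))))))
        (≡-sym (trans (concat-at-left Q back z≤n) start≡))
        (Graph.sym G (at-adj B a<size))

  module Reduction (ℓ : ℕ) (long : ∀ (C : Cycle G) → ℓ ≤ cycleLength C → 2 * ℓ ≤ cycleLength C)
                   (VS : Fin n → Set) (ES : Fin n → Fin n → Set) where
    open LongCycles ℓ long
    open Restricted VS ES

    -- The ℕ-indexed form of the hypotheses on P and Q 0, …, Q k; Q-short is (E2) with the
    -- truncated subtraction in (pv i ∸ pu i) + size (Q i) < ℓ moved to the other side.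
    record Chain (k : ℕ) (P : ℕPath) (Q : ℕ → ℕPath) (pu pv : ℕ → ℕ) : Set where
      field
        Q-start      : ∀ i → i ≤ k → at (Q i) 0 ≡ at P (pu i)
        Q-end        : ∀ i → i ≤ k → at (Q i) (size (Q i)) ≡ at P (pv i)
        pu<pv        : ∀ i → i ≤ k → pu i < pv i
        Q-avoids-P   : ∀ i → i ≤ k → InteriorAvoids (Q i) P
        far-disjoint : ∀ i j → j ≤ k → suc i < j → InteriorsDisjoint (Q i) (Q j)
        Q-short      : ∀ i → i ≤ k → pv i + size (Q i) < ℓ + pu i
        pu₀≡0        : pu 0 ≡ 0
        pvₖ≡size     : pv k ≡ size P
        staggered    : ∀ i → i < k → pu i < pu (suc i) × pu (suc i) < pv i × pv i < pv (suc i)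
        P-within     : Within P
        Q-within     : ∀ i → i ≤ k → Within (Q i)

    ShortConnection : ℕPath → Set
    ShortConnection P =
      Σ ℕPath λ R → at R 0 ≡ at P 0 × at R (size R) ≡ at P (size P) × size R < ℓ × Within R

    module ChainProperties {k P Q pu pv} (H : Chain k P Q pu pv) where
      open Chain H

      pu-mono : ∀ i j → i < j → j ≤ k → pu i < pu j
      pu-mono i (suc j) i<1+j 1+j≤k with m<1+n⇒m<n∨m≡n i<1+j
      ... | inj₁ i<j  = <-trans (pu-mono i j i<j (<⇒≤ 1+j≤k)) (proj₁ (staggered j 1+j≤k))
      ... | inj₂ refl = proj₁ (staggered j 1+j≤k)

      pv-mono : ∀ i j → i < j → j ≤ k → pv i < pv j
      pv-mono i (suc j) i<1+j 1+j≤k with m<1+n⇒m<n∨m≡n i<1+j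
      ... | inj₁ i<j  = <-trans (pv-mono i j i<j (<⇒≤ 1+j≤k)) (proj₂ (proj₂ (staggered j 1+j≤k)))
      ... | inj₂ refl = proj₂ (proj₂ (staggered j 1+j≤k))

      pv≤size : ∀ i → i ≤ k → pv i ≤ size P
      pv≤size i i≤k with m≤n⇒m<n∨m≡n i≤k
      ... | inj₁ i<k  = subst (pv i ≤_) pvₖ≡size (<⇒≤ (pv-mono i k i<k ≤-refl))
      ... | inj₂ refl = ≤-reflexive pvₖ≡size

      pu<size : ∀ i → i ≤ k → pu i < size P
      pu<size i i≤k = <-≤-trans (pu<pv i i≤k) (pv≤size i i≤k)

      Q-nonempty : ∀ i → i ≤ k → 0 < size (Q i)
      Q-nonempty i i≤k with size (Q i) in size≡
      ... | suc _ = s≤s z≤n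
      ... | zero  = ⊥-elim (<⇒≢ (pu<pv i i≤k) (at-inj P (<⇒≤ (pu<size i i≤k)) (pv≤size i i≤k)
                      (trans (≡-sym (Q-start i i≤k)) (trans (cong (at (Q i)) (≡-sym size≡)) (Q-end i i≤k)))))

      Q-meets-P-at-ends : ∀ i → i ≤ k → ∀ j → j ≤ size (Q i) → ∀ p → p ≤ size P →
                          at (Q i) j ≡ at P p →
                          (j ≡ 0 × p ≡ pu i) ⊎ (j ≡ size (Q i) × p ≡ pv i)
      Q-meets-P-at-ends i i≤k zero _ p p≤ eq =
        inj₁ (refl , at-inj P p≤ (<⇒≤ (pu<size i i≤k)) (trans (≡-sym eq) (Q-start i i≤k)))
      Q-meets-P-at-ends i i≤k (suc j) 1+j≤ p p≤ eq with m≤n⇒m<n∨m≡n 1+j≤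
      ... | inj₁ 1+j< = ⊥-elim (Q-avoids-P i i≤k (suc j) (s≤s z≤n) 1+j< (p , p≤ , ≡-sym eq))
      ... | inj₂ 1+j≡ = inj₂ (1+j≡ , at-inj P p≤ (pv≤size i i≤k)
                          (trans (≡-sym eq) (trans (cong (at (Q i)) 1+j≡) (Q-end i i≤k))))

    drop-second : ∀ {k P Q pu pv} → Chain (suc (suc k)) P Q pu pv → pu 2 < pv 0 →
                  Chain (suc k) P (Q 0 ⊲ Q) (pu 0 ⊲ pu) (pv 0 ⊲ pv)
    drop-second {k} H pu₂<pv₀ = record
      { Q-start      = λ { zero _ → Q-start 0 z≤n ; (suc i) i≤ → Q-start (2 + i) (s≤s i≤) }
      ; Q-end        = λ { zero _ → Q-end 0 z≤n ; (suc i) i≤ → Q-end (2 + i) (s≤s i≤) }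
      ; pu<pv        = λ { zero _ → pu<pv 0 z≤n ; (suc i) i≤ → pu<pv (2 + i) (s≤s i≤) }
      ; Q-avoids-P   = λ { zero _ → Q-avoids-P 0 z≤n ; (suc i) i≤ → Q-avoids-P (2 + i) (s≤s i≤) }
      ; far-disjoint = λ { zero (suc j) j≤ _ → far-disjoint 0 (2 + j) (s≤s j≤) (s≤s (s≤s z≤n))
                         ; (suc i) (suc j) j≤ i< → far-disjoint (2 + i) (2 + j) (s≤s j≤) (s≤s i<) }
      ; Q-short      = λ { zero _ → Q-short 0 z≤n ; (suc i) i≤ → Q-short (2 + i) (s≤s i≤) }
      ; pu₀≡0        = pu₀≡0
      ; pvₖ≡size     = pvₖ≡size
      ; staggered    = λ { zero _ → pu-mono 0 2 (s≤s z≤n) 2≤2+k , pu₂<pv₀ , pv-mono 0 2 (s≤s z≤n) 2≤2+k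
                         ; (suc i) i< → staggered (2 + i) (s≤s i<) }
      ; P-within     = P-within
      ; Q-within     = λ { zero _ → Q-within 0 z≤n ; (suc i) i≤ → Q-within (2 + i) (s≤s i≤) }
      }
      where
      open Chain H
      open ChainProperties H
      2≤2+k : 2 ≤ 2 + k
      2≤2+k = s≤s (s≤s z≤n)

    module Rebasing {k P Q pu pv} (H : Chain (suc k) P Q pu pv) where
      open Chain H
      open ChainProperties H

      L₀ = size (Q 0)
      w  = size P ∸ pv 0

      pv₀+w≡size : pv 0 + w ≡ size P
      pv₀+w≡size = m+[n∸m]≡n (pv≤size 0 z≤n)

      P-tail = subpath P (pv 0) w (≤-reflexive pv₀+w≡size)

      tail-joined : at (Q 0) L₀ ≡ at P (pv 0 + 0)
      tail-joined = trans (Q-end 0 z≤n) (cong (at P) (≡-sym (+-identityʳ _)))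

      tail-disjoint : DisjointBefore (Q 0) P-tail
      tail-disjoint {i} {j} i< j≤ eq
        with Q-meets-P-at-ends 0 z≤n i (<⇒≤ i<) (pv 0 + j)
               (subst (pv 0 + j ≤_) pv₀+w≡size (+-monoʳ-≤ (pv 0) j≤)) eq
      ... | inj₁ (_ , p≡) = <⇒≱ (pu<pv 0 z≤n) (subst (pv 0 ≤_) p≡ (m≤m+n (pv 0) j))
      ... | inj₂ (i≡ , _) = <⇒≢ i< i≡

      P′ = concat (Q 0) P-tail tail-joined tail-disjoint

      P′-head : ∀ {i} → i ≤ L₀ → at P′ i ≡ at (Q 0) i
      P′-head = concat-at-left (Q 0) P-tail

      P′-tail : ∀ j → at P′ (L₀ + j) ≡ at P (pv 0 + j)
      P′-tail j = concat-at-right (Q 0) P-tail j tail-joined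

      Visits-P′ : ∀ x → Visits P′ x → Visits (Q 0) x ⊎ Visits P x
      Visits-P′ x v with Visits-concat (Q 0) P-tail tail-joined tail-disjoint x v
      ... | inj₁ v₀ = inj₁ v₀
      ... | inj₂ v₁ = inj₂ (Visits-subpath P (pv 0) w (≤-reflexive pv₀+w≡size) x v₁)

      P′-within : Within P′
      P′-within = Within-concat (Q 0) P-tail tail-joined tail-disjoint (Q-within 0 z≤n)
                    (Within-subpath P (pv 0) w (≤-reflexive pv₀+w≡size) P-within)

      P′-start : at P′ 0 ≡ at P 0
      P′-start = trans (P′-head z≤n) (trans (Q-start 0 z≤n) (cong (at P) pu₀≡0))

      P′-end : at P′ (size P′) ≡ at P (size P)
      P′-end = trans (P′-tail w) (cong (at P) pv₀+w≡size)

      shift : ℕ → ℕ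
      shift p = L₀ + (p ∸ pv 0)

      at-shift : ∀ p → pv 0 ≤ p → at P p ≡ at P′ (shift p)
      at-shift p pv₀≤p = trans (cong (at P) (≡-sym (m+[n∸m]≡n pv₀≤p))) (≡-sym (P′-tail (p ∸ pv 0)))

      shift-< : ∀ {x y} → x < y → pv 0 ≤ x → shift x < shift y
      shift-< x<y pv₀≤x = +-monoʳ-< L₀ (∸-monoˡ-< x<y pv₀≤x)

    -- Q 1 leaves Q 0 for the last time at Q 1 t = Q 0 s; Q 0 up to s followed by Q 1 from t
    -- replaces Q 0 and Q 1.
    module Merging {k P Q pu pv} (H : Chain (suc k) P Q pu pv) (t s : ℕ) (0<t : 0 < t) (t<L₁ : t < size (Q 1))
                   (s≤L₀ : s ≤ size (Q 0)) (meet : at (Q 0) s ≡ at (Q 1) t)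
                   (last : ∀ j → t < j → j < size (Q 1) → ¬ (0 < j × Visits (Q 0) (at (Q 1) j))) where
      open Chain H
      open ChainProperties H
      open Rebasing H

      L₁ = size (Q 1)
      r  = L₁ ∸ t

      t+r≡L₁ : t + r ≡ L₁
      t+r≡L₁ = m+[n∸m]≡n (<⇒≤ t<L₁)

      0<r : 0 < r
      0<r = m<n⇒0<n∸m t<L₁

      0<s : 0 < s
      0<s = ≤∧≢⇒< z≤n λ s≡0 → Q-avoids-P 1 (s≤s z≤n) t 0<t t<L₁
        (pu 0 , <⇒≤ (pu<size 0 z≤n) , trans (≡-sym (Q-start 0 z≤n)) (trans (cong (at (Q 0)) s≡0) meet))

      s<L₀ : s < L₀
      s<L₀ = ≤∧≢⇒< s≤L₀ λ s≡L₀ → Q-avoids-P 1 (s≤s z≤n) t 0<t t<L₁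
        (pv 0 , pv≤size 0 z≤n , trans (≡-sym (Q-end 0 z≤n)) (trans (cong (at (Q 0)) (≡-sym s≡L₀)) meet))

      head = subpath (Q 0) 0 s s≤L₀
      tail = subpath (Q 1) t r (≤-reflexive t+r≡L₁)

      joined : at (Q 0) (0 + s) ≡ at (Q 1) (t + 0)
      joined = trans meet (cong (at (Q 1)) (≡-sym (+-identityʳ t)))

      0<t+ : ∀ j → 0 < t + j
      0<t+ j = ≤-trans 0<t (m≤m+n t j)

      t+<L₁ : ∀ {j} → j < r → t + j < L₁
      t+<L₁ {j} j<r = subst (t + j <_) t+r≡L₁ (+-monoʳ-< t j<r)

      pu₀<pv₁ : pu 0 < pv 1
      pu₀<pv₁ = <-trans (pu-mono 0 1 (s≤s z≤n) (s≤s z≤n)) (pu<pv 1 (s≤s z≤n))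

      disjoint : DisjointBefore head tail
      disjoint {i} {zero} i<s _ eq =
        <⇒≢ i<s (at-inj (Q 0) (<⇒≤ (<-trans i<s s<L₀)) s≤L₀
                  (trans eq (trans (cong (at (Q 1)) (+-identityʳ t)) (≡-sym meet))))
      disjoint {i} {suc j} i<s j< eq with m≤n⇒m<n∨m≡n (subst (t + suc j ≤_) t+r≡L₁ (+-monoʳ-≤ t j<))
      ... | inj₁ inner = last (t + suc j) (m<m+n t (s≤s z≤n)) inner (0<t+ (suc j) , i , <⇒≤ (<-trans i<s s<L₀) , eq)
      ... | inj₂ final with Q-meets-P-at-ends 0 z≤n i (<⇒≤ (<-trans i<s s<L₀)) (pv 1) (pv≤size 1 (s≤s z≤n))
                              (trans eq (trans (cong (at (Q 1)) final) (Q-end 1 (s≤s z≤n))))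
      ...   | inj₁ (_ , pv₁≡) = <⇒≢ pu₀<pv₁ (≡-sym pv₁≡)
      ...   | inj₂ (i≡ , _)   = <⇒≢ (<-trans i<s s<L₀) i≡

      merged = concat head tail joined disjoint

      merged-start : at merged 0 ≡ at P (pu 0)
      merged-start = trans (concat-at-left head tail z≤n) (Q-start 0 z≤n)

      merged-end : at merged (s + r) ≡ at P (pv 1)
      merged-end = trans (concat-at-right head tail r joined) (trans (cong (at (Q 1)) t+r≡L₁) (Q-end 1 (s≤s z≤n)))

      merged-interior : ∀ i → 0 < i → i < s + r →
        (∃ λ j → 0 < j × j < L₀ × at merged i ≡ at (Q 0) j) ⊎
        (∃ λ j → 0 < j × j < L₁ × at merged i ≡ at (Q 1) j)
      merged-interior i 0<i i< with ≤-or-beyond s i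
      ... | inj₁ i≤s = inj₁ (i , 0<i , ≤-<-trans i≤s s<L₀ , concat-at-left head tail i≤s)
      ... | inj₂ (j , refl) =
        inj₂ (t + suc j , 0<t+ (suc j) , t+<L₁ (+-cancelˡ-< s _ _ i<) , concat-at-right head tail (suc j) joined)

      merged-avoids : ∀ X → InteriorAvoids (Q 0) X → InteriorAvoids (Q 1) X → InteriorAvoids merged X
      merged-avoids X avoids₀ avoids₁ i 0<i i< v with merged-interior i 0<i i<
      ... | inj₁ (j , 0<j , j< , eq) = avoids₀ j 0<j j< (subst (Visits X) eq v)
      ... | inj₂ (j , 0<j , j< , eq) = avoids₁ j 0<j j< (subst (Visits X) eq v)

      Visits-merged : ∀ x → Visits merged x → Visits (Q 0) x ⊎ Visits (Q 1) x
      Visits-merged x v with Visits-concat head tail joined disjoint x v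
      ... | inj₁ v₀ = inj₁ (Visits-subpath (Q 0) 0 s s≤L₀ x v₀)
      ... | inj₂ v₁ = inj₂ (Visits-subpath (Q 1) t r (≤-reflexive t+r≡L₁) x v₁)

      e = L₀ ∸ suc s
      c = pv 1 ∸ suc (pv 0)

      1+s+e≡L₀ : suc s + e ≡ L₀
      1+s+e≡L₀ = m+[n∸m]≡n s<L₀

      1+pv₀+c≡pv₁ : suc (pv 0) + c ≡ pv 1
      1+pv₀+c≡pv₁ = m+[n∸m]≡n (pv-mono 0 1 (s≤s z≤n) (s≤s z≤n))

      -- The detour: tail, closed up by P′ (Q 0 from s, then P up to pv 1).
      detour-short : suc (e + suc c) + r < ℓ
      detour-short = ear-short P′ tail s (e + suc c) within-P′ tail-start tail-end tail-avoids
        (subst (2 ≤_) (≡-sym (+-assoc e (suc c) r)) (2≤+ e (s≤s z≤n) 0<r))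
        (detour-<2ℓ ℓ s e c t r 1+s+e≡L₀ 1+pv₀+c≡pv₁ t+r≡L₁ pu₀≡0
          (Q-short 0 z≤n) (Q-short 1 (s≤s z≤n)) (proj₁ (proj₂ (staggered 0 (s≤s z≤n)))))
        where
        position≡ : s + suc (e + suc c) ≡ L₀ + suc c
        position≡ = begin
          s + suc (e + suc c)   ≡⟨ +-suc s (e + suc c) ⟩
          suc s + (e + suc c)   ≡⟨ ≡-sym (+-assoc (suc s) e (suc c)) ⟩
          suc s + e + suc c     ≡⟨ cong (_+ suc c) 1+s+e≡L₀ ⟩
          L₀ + suc c            ∎
          where open ≡-Reasoning
        within-P′ : s + suc (e + suc c) ≤ size P′
        within-P′ = subst (_≤ L₀ + w) (≡-sym position≡) (+-monoʳ-≤ L₀ (+-cancelˡ-≤ (pv 0) _ _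
          (subst₂ _≤_ (trans (≡-sym 1+pv₀+c≡pv₁) (≡-sym (+-suc (pv 0) c))) (≡-sym pv₀+w≡size)
            (pv≤size 1 (s≤s z≤n)))))
        tail-start : at tail 0 ≡ at P′ s
        tail-start = trans (≡-sym joined) (≡-sym (P′-head s≤L₀))
        tail-end : at tail r ≡ at P′ (s + suc (e + suc c))
        tail-end = trans (cong (at (Q 1)) t+r≡L₁) (trans (Q-end 1 (s≤s z≤n))
          (trans (cong (at P) (trans (≡-sym 1+pv₀+c≡pv₁) (≡-sym (+-suc (pv 0) c))))
            (trans (≡-sym (P′-tail (suc c))) (cong (at P′) (≡-sym position≡)))))
        tail-avoids : InteriorAvoids tail P′
        tail-avoids i 0<i i<r v with Visits-P′ _ v
        ... | inj₁ v₀ = last (t + i) (m<m+n t 0<i) (t+<L₁ i<r) (0<t+ i , v₀)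
        ... | inj₂ v₁ = Q-avoids-P 1 (s≤s z≤n) (t + i) (0<t+ i) (t+<L₁ i<r) v₁

      merged-short : pv 1 + (s + r) < ℓ + pu 0
      merged-short = subst₂ (λ p z → p + (s + r) < z)
        1+pv₀+c≡pv₁ (trans (≡-sym (+-identityʳ ℓ)) (cong (ℓ +_) (≡-sym pu₀≡0)))
        (ear-short P merged 0 (pv 0 + c) (subst (_≤ size P) (≡-sym 1+pv₀+c≡pv₁) (pv≤size 1 (s≤s z≤n)))
          (trans merged-start (cong (at P) pu₀≡0)) (trans merged-end (cong (at P) (≡-sym 1+pv₀+c≡pv₁)))
          (merged-avoids P (Q-avoids-P 0 z≤n) (Q-avoids-P 1 (s≤s z≤n))) (2≤+ (pv 0 + c) 0<s 0<r)
          (merged-<2ℓ ℓ s e (pv 0) c r 1+s+e≡L₀ pu₀≡0 (Q-short 0 z≤n) detour-short))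

      merged-chain : Chain k P (merged ⊲ Q) (pu 0 ⊲ pu) (pv 1 ⊲ pv)
      merged-chain = record
        { Q-start      = λ { zero _ → merged-start ; (suc i) i≤ → Q-start (2 + i) (s≤s i≤) }
        ; Q-end        = λ { zero _ → merged-end ; (suc i) i≤ → Q-end (2 + i) (s≤s i≤) }
        ; pu<pv        = λ { zero _ → pu₀<pv₁ ; (suc i) i≤ → pu<pv (2 + i) (s≤s i≤) }
        ; Q-avoids-P   = λ { zero _ → merged-avoids P (Q-avoids-P 0 z≤n) (Q-avoids-P 1 (s≤s z≤n))
                           ; (suc i) i≤ → Q-avoids-P (2 + i) (s≤s i≤) }
        ; far-disjoint = λ { zero (suc j) j≤ 1<1+j → merged-disjoint j j≤ 1<1+j
                           ; (suc i) (suc j) j≤ i< → far-disjoint (2 + i) (2 + j) (s≤s j≤) (s≤s i<) }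
        ; Q-short      = λ { zero _ → merged-short ; (suc i) i≤ → Q-short (2 + i) (s≤s i≤) }
        ; pu₀≡0        = pu₀≡0
        ; pvₖ≡size     = ⊲-last k pv (λ { refl → pvₖ≡size }) pvₖ≡size
        ; staggered    = λ { zero 0<k → pu-mono 0 2 (s≤s z≤n) (s≤s 0<k) , proj₂ (staggered 1 (s≤s 0<k))
                           ; (suc i) i< → staggered (2 + i) (s≤s i<) }
        ; P-within     = P-within
        ; Q-within     = λ { zero _ → Within-concat head tail joined disjoint
                                        (Within-subpath (Q 0) 0 s s≤L₀ (Q-within 0 z≤n))
                                        (Within-subpath (Q 1) t r (≤-reflexive t+r≡L₁) (Q-within 1 (s≤s z≤n)))
                           ; (suc i) i≤ → Q-within (2 + i) (s≤s i≤) }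
        }
        where
        merged-disjoint : ∀ j → suc j ≤ k → 1 < suc j → InteriorsDisjoint merged (Q (2 + j))
        merged-disjoint j j≤ 1<1+j =
          merged-avoids (Q (2 + j)) (proj₁ far₀) (proj₁ far₁) ,
          λ i 0<i i< v → [ proj₂ far₀ i 0<i i< , proj₂ far₁ i 0<i i< ]′ (Visits-merged _ v)
          where
          far₀ = far-disjoint 0 (2 + j) (s≤s j≤) (s≤s (s≤s z≤n))
          far₁ = far-disjoint 1 (2 + j) (s≤s j≤) (s≤s 1<1+j)

    -- No inner vertex of Q 1 lies on Q 0, and Q 2, Q 3, … start beyond pv 0: P up to pu 1
    -- followed by Q 1 is then a P′-path that replaces Q 0 and Q 1.
    module Rerouting {k P Q pu pv} (H : Chain (suc k) P Q pu pv) (pv₀≤pu₂ : 1 ≤ k → pv 0 ≤ pu 2)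
                     (Q₁-misses-Q₀ : ∀ t → t < size (Q 1) → ¬ (0 < t × Visits (Q 0) (at (Q 1) t))) where
      open Chain H
      open ChainProperties H
      open Rebasing H

      L₁ = size (Q 1)

      pv₀≤pu : ∀ j → 2 ≤ j → j ≤ suc k → pv 0 ≤ pu j
      pv₀≤pu 1 (s≤s ())
      pv₀≤pu 2 _ j≤ = pv₀≤pu₂ (≤-pred j≤)
      pv₀≤pu (suc (suc (suc j))) _ j≤ =
        ≤-trans (pv₀≤pu₂ (≤-trans (s≤s z≤n) (≤-pred j≤)))
          (<⇒≤ (pu-mono 2 (3 + j) (s≤s (s≤s (s≤s z≤n))) j≤))

      pv₀≤pv : ∀ j → j ≤ suc k → pv 0 ≤ pv j
      pv₀≤pv zero    _  = ≤-refl
      pv₀≤pv (suc j) j≤ = <⇒≤ (pv-mono 0 (suc j) (s≤s z≤n) j≤)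

      pu₁<pv₀ : pu 1 < pv 0
      pu₁<pv₀ = proj₁ (proj₂ (staggered 0 (s≤s z≤n)))

      0<pu₁ : 0 < pu 1
      0<pu₁ = subst (_< pu 1) pu₀≡0 (proj₁ (staggered 0 (s≤s z≤n)))

      pu₁≤size : 0 + pu 1 ≤ size P
      pu₁≤size = <⇒≤ (pu<size 1 (s≤s z≤n))

      P-head = subpath P 0 (pu 1) pu₁≤size

      joined : at P (0 + pu 1) ≡ at (Q 1) 0
      joined = ≡-sym (Q-start 1 (s≤s z≤n))

      disjoint : DisjointBefore P-head (Q 1)
      disjoint {i} {j} i< j≤ eq
        with Q-meets-P-at-ends 1 (s≤s z≤n) j j≤ i (≤-trans (<⇒≤ i<) pu₁≤size) (≡-sym eq)
      ... | inj₁ (_ , i≡) = <⇒≢ i< i≡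
      ... | inj₂ (_ , i≡) = <⇒≢ (<-trans i< (pu<pv 1 (s≤s z≤n))) i≡

      rerouted = concat P-head (Q 1) joined disjoint

      rerouted-start : at rerouted 0 ≡ at P′ 0
      rerouted-start = trans (concat-at-left P-head (Q 1) z≤n) (≡-sym P′-start)

      rerouted-end : at rerouted (pu 1 + L₁) ≡ at P′ (shift (pv 1))
      rerouted-end = trans (concat-at-right P-head (Q 1) L₁ joined)
        (trans (Q-end 1 (s≤s z≤n)) (at-shift (pv 1) (pv₀≤pv 1 (s≤s z≤n))))

      P-head-avoids-P′ : ∀ i → 0 < i → i ≤ pu 1 → ¬ Visits P′ (at P i)
      P-head-avoids-P′ i 0<i i≤pu₁ v with Visits-concat (Q 0) P-tail tail-joined tail-disjoint _ v
      ... | inj₁ (j , j≤ , eq) with Q-meets-P-at-ends 0 z≤n j j≤ i (≤-trans i≤pu₁ pu₁≤size) eq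
      ...   | inj₁ (_ , i≡) = <⇒≢ 0<i (≡-sym (trans i≡ pu₀≡0))
      ...   | inj₂ (_ , i≡) = <⇒≢ (≤-<-trans i≤pu₁ pu₁<pv₀) i≡
      P-head-avoids-P′ i _ i≤pu₁ _ | inj₂ (j , j≤ , eq) =
        <⇒≱ (≤-<-trans i≤pu₁ pu₁<pv₀)
          (subst (pv 0 ≤_) (at-inj P (subst (pv 0 + j ≤_) pv₀+w≡size (+-monoʳ-≤ (pv 0) j≤))
                                     (≤-trans i≤pu₁ pu₁≤size) eq)
            (m≤m+n (pv 0) j))

      rerouted-avoids : InteriorAvoids rerouted P′
      rerouted-avoids i 0<i i< v with ≤-or-beyond (pu 1) i
      ... | inj₁ i≤pu₁ =
        P-head-avoids-P′ i 0<i i≤pu₁ (subst (Visits P′) (concat-at-left P-head (Q 1) i≤pu₁) v)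
      ... | inj₂ (j , refl) with Visits-P′ _ (subst (Visits P′) (concat-at-right P-head (Q 1) (suc j) joined) v)
      ...   | inj₁ v₀ = Q₁-misses-Q₀ (suc j) (+-cancelˡ-< (pu 1) _ _ i<) (s≤s z≤n , v₀)
      ...   | inj₂ v₁ = Q-avoids-P 1 (s≤s z≤n) (suc j) (s≤s z≤n) (+-cancelˡ-< (pu 1) _ _ i<) v₁

      Q-avoids-P′ : ∀ j → 2 ≤ j → j ≤ suc k → InteriorAvoids (Q j) P′
      Q-avoids-P′ j 2≤j j≤ i 0<i i< v with Visits-P′ _ v
      ... | inj₁ v₀ = proj₂ (far-disjoint 0 j j≤ 2≤j) i 0<i i< v₀
      ... | inj₂ v₁ = Q-avoids-P j j≤ i 0<i i< v₁

      rerouted-disjoint : ∀ j → 3 ≤ j → j ≤ suc k → InteriorsDisjoint rerouted (Q j)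
      rerouted-disjoint j 3≤j j≤ = rerouted-avoids-Q , Q-avoids-rerouted
        where
        pu₁<pu : pu 1 < pu j
        pu₁<pu = pu-mono 1 j (≤-trans (s≤s (s≤s z≤n)) 3≤j) j≤
        rerouted-avoids-Q : InteriorAvoids rerouted (Q j)
        rerouted-avoids-Q i 0<i i< v with ≤-or-beyond (pu 1) i
        ... | inj₁ i≤pu₁ with subst (Visits (Q j)) (concat-at-left P-head (Q 1) i≤pu₁) v
        ...   | (m , m≤ , eq) with Q-meets-P-at-ends j j≤ m m≤ i (≤-trans i≤pu₁ pu₁≤size) eq
        ...     | inj₁ (_ , i≡) = <⇒≱ pu₁<pu (subst (_≤ pu 1) i≡ i≤pu₁)
        ...     | inj₂ (_ , i≡) = <⇒≱ (<-trans pu₁<pu (pu<pv j j≤)) (subst (_≤ pu 1) i≡ i≤pu₁)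
        rerouted-avoids-Q _ 0<i i< v | inj₂ (m , refl) =
          proj₁ (far-disjoint 1 j j≤ 3≤j) (suc m) (s≤s z≤n) (+-cancelˡ-< (pu 1) _ _ i<)
            (subst (Visits (Q j)) (concat-at-right P-head (Q 1) (suc m) joined) v)
        Q-avoids-rerouted : InteriorAvoids (Q j) rerouted
        Q-avoids-rerouted i 0<i i< v with Visits-concat P-head (Q 1) joined disjoint _ v
        ... | inj₁ v₀ = Q-avoids-P j j≤ i 0<i i< (Visits-subpath P 0 (pu 1) pu₁≤size _ v₀)
        ... | inj₂ v₁ = proj₂ (far-disjoint 1 j j≤ 3≤j) i 0<i i< v₁

      rerouted-short : shift (pv 1) + (pu 1 + L₁) < ℓ + 0
      rerouted-short = subst₂ (λ x z → x + (pu 1 + L₁) < z) (cong (_+ c) 1+a≡L₀) (≡-sym (+-identityʳ ℓ))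
        (ear-short P′ rerouted 0 (a + c) within-P′ rerouted-start
          (trans rerouted-end (cong (λ z → at P′ (z + c)) (≡-sym 1+a≡L₀))) rerouted-avoids
          (2≤+ (a + c) 0<pu₁ (Q-nonempty 1 (s≤s z≤n)))
          (rerouted-<2ℓ ℓ a c (pu 1) L₁ 1+a≡L₀ (m+[n∸m]≡n (pv₀≤pv 1 (s≤s z≤n))) pu₀≡0
            (Q-short 0 z≤n) (Q-short 1 (s≤s z≤n)) pu₁<pv₀))
        where
        a = L₀ ∸ 1
        c = pv 1 ∸ pv 0
        1+a≡L₀ : suc a ≡ L₀
        1+a≡L₀ = m+[n∸m]≡n (Q-nonempty 0 z≤n)
        within-P′ : 0 + suc (a + c) ≤ size P′
        within-P′ = subst (_≤ L₀ + w) (cong (_+ c) (≡-sym 1+a≡L₀))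
          (+-monoʳ-≤ L₀ (∸-monoˡ-≤ (pv 0) (pv≤size 1 (s≤s z≤n))))

      rerouted-chain : Chain k P′ (rerouted ⊲ Q) (0 ⊲ (shift ∘ pu)) (shift (pv 1) ⊲ (shift ∘ pv))
      rerouted-chain = record
        { Q-start      = λ { zero _ → rerouted-start
                           ; (suc i) i≤ → trans (Q-start (2 + i) (s≤s i≤))
                                                 (at-shift _ (pv₀≤pu (2 + i) 2≤2+ (s≤s i≤))) }
        ; Q-end        = λ { zero _ → rerouted-end
                           ; (suc i) i≤ → trans (Q-end (2 + i) (s≤s i≤))
                                                 (at-shift _ (pv₀≤pv (2 + i) (s≤s i≤))) }
        ; pu<pv        = λ { zero _ → ≤-trans (Q-nonempty 0 z≤n) (m≤m+n L₀ _)
                           ; (suc i) i≤ → shift-< (pu<pv (2 + i) (s≤s i≤)) (pv₀≤pu (2 + i) 2≤2+ (s≤s i≤)) }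
        ; Q-avoids-P   = λ { zero _ → rerouted-avoids ; (suc i) i≤ → Q-avoids-P′ (2 + i) 2≤2+ (s≤s i≤) }
        ; far-disjoint = λ { zero (suc j) j≤ 1<1+j → rerouted-disjoint (2 + j) (s≤s 1<1+j) (s≤s j≤)
                           ; (suc i) (suc j) j≤ i< → far-disjoint (2 + i) (2 + j) (s≤s j≤) (s≤s i<) }
        ; Q-short      = λ { zero _ → rerouted-short
                           ; (suc i) i≤ → short-shift (pv₀≤pu (2 + i) 2≤2+ (s≤s i≤)) (pv₀≤pv (2 + i) (s≤s i≤))
                                            (Q-short (2 + i) (s≤s i≤)) }
        ; pu₀≡0        = refl
        ; pvₖ≡size     = ⊲-last k (shift ∘ pv) (λ { refl → shifted-end }) shifted-end
        ; staggered    = λ { zero 0<k → ≤-trans (Q-nonempty 0 z≤n) (m≤m+n L₀ _) ,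
                                          shift-< (proj₁ (proj₂ (staggered 1 (s≤s 0<k)))) (pv₀≤pu₂ 0<k) ,
                                          shift-< (proj₂ (proj₂ (staggered 1 (s≤s 0<k)))) (pv₀≤pv 1 (s≤s z≤n))
                           ; (suc i) i< → let (pu< , pu<pv , pv<) = staggered (2 + i) (s≤s i<) in
                               shift-< pu< (pv₀≤pu (2 + i) 2≤2+ (s≤s (<⇒≤ i<))) ,
                               shift-< pu<pv (pv₀≤pu (3 + i) 2≤2+ (s≤s i<)) ,
                               shift-< pv< (pv₀≤pv (2 + i) (s≤s (<⇒≤ i<))) }
        ; P-within     = P′-within
        ; Q-within     = λ { zero _ → Within-concat P-head (Q 1) joined disjoint
                                        (Within-subpath P 0 (pu 1) pu₁≤size P-within) (Q-within 1 (s≤s z≤n))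
                           ; (suc i) i≤ → Q-within (2 + i) (s≤s i≤) }
        }
        where
        2≤2+ : ∀ {i} → 2 ≤ 2 + i
        2≤2+ = s≤s (s≤s z≤n)
        shifted-end : shift (pv (suc k)) ≡ size P′
        shifted-end = cong (λ p → L₀ + (p ∸ pv 0)) pvₖ≡size

    lone-ear : ∀ {P Q pu pv} → Chain 0 P Q pu pv → ShortConnection P
    lone-ear {P} {Q} {pu} {pv} H =
      Q 0 , trans (Q-start 0 z≤n) (cong (at P) pu₀≡0) , trans (Q-end 0 z≤n) (cong (at P) pvₖ≡size) ,
      ≤-<-trans (m≤n+m (size (Q 0)) (pv 0)) (subst (pv 0 + size (Q 0) <_) ℓ+pu₀≡ℓ (Q-short 0 z≤n)) ,
      Q-within 0 z≤n
      where
      open Chain H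
      ℓ+pu₀≡ℓ : ℓ + pu 0 ≡ ℓ
      ℓ+pu₀≡ℓ = trans (cong (ℓ +_) pu₀≡0) (+-identityʳ ℓ)

    ShortConnection-transport : ∀ {P P′} → at P′ 0 ≡ at P 0 → at P′ (size P′) ≡ at P (size P) →
                                ShortConnection P′ → ShortConnection P
    ShortConnection-transport start≡ end≡ (R , R-start , R-end , R-short , R-within) =
      R , trans R-start start≡ , trans R-end end≡ , R-short , R-within

    reduce-first-two : ∀ {k P Q pu pv} → Chain (suc k) P Q pu pv → (1 ≤ k → pv 0 ≤ pu 2) →
                       (∀ {P Q pu pv} → Chain k P Q pu pv → ShortConnection P) → ShortConnection P
    reduce-first-two {P = P} {Q} H pv₀≤pu₂ shorten-k
      with last-below (λ t → (0 <? t) ×-dec Visits? (Q 0) (at (Q 1) t)) (size (Q 1))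
    ... | inj₁ misses =
      ShortConnection-transport {P} {Rebasing.P′ H} (Rebasing.P′-start H) (Rebasing.P′-end H)
        (shorten-k (Rerouting.rerouted-chain H pv₀≤pu₂ misses))
    ... | inj₂ (t , t< , (0<t , (s , s≤ , meet)) , last) =
      shorten-k (Merging.merged-chain H t s 0<t t< s≤ meet last)

    shorten-step : ∀ k → (∀ {P Q pu pv} → Chain k P Q pu pv → ShortConnection P) →
                   ∀ {P Q pu pv} → Chain (suc k) P Q pu pv → ShortConnection P
    shorten-step zero    shorten-k H = reduce-first-two H (λ ()) shorten-k
    shorten-step (suc k) shorten-k {pu = pu} {pv} H with pu 2 <? pv 0
    ... | yes pu₂<pv₀ = shorten-k (drop-second H pu₂<pv₀)
    ... | no  pu₂≮pv₀ = reduce-first-two H (λ _ → ≮⇒≥ pu₂≮pv₀) shorten-k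

    shorten : ∀ k {P Q pu pv} → Chain k P Q pu pv → ShortConnection P
    shorten zero    = lone-ear
    shorten (suc k) = shorten-step k (shorten k)

-- Reading a position i as an element of Fin (suc m); out-of-range positions give the junk value zero.
clamp : ∀ {m} → ℕ → Fin (suc m)
clamp {m} i with i ≤? m
... | yes i≤m = fromℕ< (s≤s i≤m)
... | no  _   = zero

toℕ-clamp : ∀ {m} i → i ≤ m → toℕ (clamp {m} i) ≡ i
toℕ-clamp {m} i i≤m with i ≤? m
... | yes _   = toℕ-fromℕ< _
... | no  i≰m = contradiction i≤m i≰m

clamp-toℕ : ∀ {m} (x : Fin (suc m)) → clamp (toℕ x) ≡ x
clamp-toℕ x = toℕ-injective (toℕ-clamp (toℕ x) (≤-pred (toℕ<n x)))

clamp-inject₁ : ∀ {m} i (i<m : i < m) → clamp {m} i ≡ inject₁ (fromℕ< i<m)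
clamp-inject₁ i i<m = toℕ-injective
  (trans (toℕ-clamp i (<⇒≤ i<m)) (≡-sym (trans (toℕ-inject₁ (fromℕ< i<m)) (toℕ-fromℕ< i<m))))

clamp-suc : ∀ {m} i (i<m : i < m) → clamp {m} (suc i) ≡ suc (fromℕ< i<m)
clamp-suc i i<m = toℕ-injective (trans (toℕ-clamp (suc i) i<m) (cong suc (≡-sym (toℕ-fromℕ< i<m))))

module _ {n : ℕ} {G : Graph n} where

  toℕPath : Path G → ℕPath G
  toℕPath P = record
    { size   = len P
    ; at     = λ i → vtx P (clamp i)
    ; at-inj = λ {i} {j} i≤ j≤ eq →
        trans (≡-sym (toℕ-clamp i i≤)) (trans (cong toℕ (Path.inj P eq)) (toℕ-clamp j j≤))
    ; at-adj = λ {i} i< → subst₂ (λ a b → Adj G (vtx P a) (vtx P b))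
        (≡-sym (clamp-inject₁ i i<)) (≡-sym (clamp-suc i i<)) (Path.adj P (fromℕ< i<)) }

  fromℕPath : ℕPath G → Path G
  fromℕPath R = record
    { len = size R
    ; vtx = λ x → at R (toℕ x)
    ; inj = λ {x} {y} eq → toℕ-injective (at-inj R (≤-pred (toℕ<n x)) (≤-pred (toℕ<n y)) eq)
    ; adj = λ x → subst (λ z → Adj G (at R z) (at R (suc (toℕ x)))) (≡-sym (toℕ-inject₁ x))
                    (at-adj R (toℕ<n x)) }

  at-toℕPath : ∀ P (x : Fin (suc (len P))) → at (toℕPath P) (toℕ x) ≡ vtx P x
  at-toℕPath P x = cong (vtx P) (clamp-toℕ x)

  start-toℕPath : ∀ P → at (toℕPath P) 0 ≡ start P
  start-toℕPath P = at-toℕPath P zero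

  end-toℕPath : ∀ P → at (toℕPath P) (len P) ≡ end P
  end-toℕPath P = trans (cong (at (toℕPath P)) (≡-sym (toℕ-fromℕ (len P)))) (at-toℕPath P (fromℕ (len P)))

  InteriorAvoids-toℕPath : ∀ P R → (∀ x → InternalVertexOf P x → ¬ VertexOf R x) →
                           InteriorAvoids G (toℕPath P) (toℕPath R)
  InteriorAvoids-toℕPath P R avoids i 0<i i< (j , _ , eq) =
    avoids _ (clamp i , subst (0 <_) clamp≡ 0<i , subst (_< len P) clamp≡ i< , refl) (clamp j , eq)
    where
    clamp≡ : i ≡ toℕ (clamp {len P} i)
    clamp≡ = ≡-sym (toℕ-clamp i (<⇒≤ i<))

  EdgeOf-toℕPath : ∀ P i → i < len P → EdgeOf P (at (toℕPath P) i) (at (toℕPath P) (suc i))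
  EdgeOf-toℕPath P i i< =
    fromℕ< i< , inj₁ (cong (vtx P) (≡-sym (clamp-inject₁ i i<)) , cong (vtx P) (≡-sym (clamp-suc i i<)))

  EdgeOf-sym : ∀ (P : Path G) {x y} → EdgeOf P x y → EdgeOf P y x
  EdgeOf-sym P (i , inj₁ (x≡ , y≡)) = i , inj₂ (x≡ , y≡)
  EdgeOf-sym P (i , inj₂ (y≡ , x≡)) = i , inj₁ (y≡ , x≡)

short-without-∸ : ∀ {a b L ℓ} → a < b → (b ∸ a) + L < ℓ → b + L < ℓ + a
short-without-∸ {a} {b} {L} {ℓ} a<b h = subst (_≤ ℓ + a) (cong suc (begin
  b ∸ a + L + a    ≡⟨ +-assoc (b ∸ a) L a ⟩
  b ∸ a + (L + a)  ≡⟨ cong (b ∸ a +_) (+-comm L a) ⟩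
  b ∸ a + (a + L)  ≡⟨ ≡-sym (+-assoc (b ∸ a) a L) ⟩
  b ∸ a + a + L    ≡⟨ cong (_+ L) (m∸n+n≡m (<⇒≤ a<b)) ⟩
  b + L            ∎)) (+-monoˡ-≤ a h)
  where open ≡-Reasoning

module Embedding {n : ℕ} (G : Graph n) (ℓ : ℕ)
                 (long : ∀ (C : Cycle G) → ℓ ≤ cycleLength C → 2 * ℓ ≤ cycleLength C)
                 (P : Path G) {k : ℕ} (Q : Fin (suc k) → Path G) (pu pv : Fin (suc k) → Fin (suc (len P))) where

  InUnion : Fin n → Set
  InUnion x = VertexOf P x ⊎ ∃ λ j → VertexOf (Q j) x

  EdgeInUnion : Fin n → Fin n → Set
  EdgeInUnion x y = EdgeOf P x y ⊎ ∃ λ j → EdgeOf (Q j) x y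

  open Reduction G ℓ long InUnion EdgeInUnion public

  Attached : Set
  Attached = ∀ i → start (Q i) ≡ vtx P (pu i) × end (Q i) ≡ vtx P (pv i) × toℕ (pu i) < toℕ (pv i)

  FarDisjoint : Set
  FarDisjoint = ∀ i j → (suc (toℕ i) < toℕ j ⊎ suc (toℕ j) < toℕ i) → InternallyDisjoint (Q i) (Q j)

  ShortCycles : Set
  ShortCycles = ∀ i → subpathCycleLength P (pu i) (pv i) (Q i) < ℓ

  Staggered : Set
  Staggered = ∀ (i : Fin k) → toℕ (pu (inject₁ i)) < toℕ (pu (suc i))
                              × toℕ (pu (suc i)) < toℕ (pv (inject₁ i))
                              × toℕ (pv (inject₁ i)) < toℕ (pv (suc i))

  P⁺ : ℕPath G
  P⁺ = toℕPath P

  Q⁺ : ℕ → ℕPath G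
  Q⁺ i = toℕPath (Q (clamp i))

  pu⁺ pv⁺ : ℕ → ℕ
  pu⁺ i = toℕ (pu (clamp i))
  pv⁺ i = toℕ (pv (clamp i))

  chain : (∀ i → IsPPath P (Q i)) → Attached → FarDisjoint → ShortCycles →
          pu zero ≡ zero → pv (fromℕ k) ≡ fromℕ (len P) → Staggered → Chain k P⁺ Q⁺ pu⁺ pv⁺
  chain isPPath attached far short pu₀≡0 pvₖ≡end staggered = record
    { Q-start      = λ i _ → trans (start-toℕPath (Q (clamp i)))
                               (trans (proj₁ (attached (clamp i))) (≡-sym (at-toℕPath P _)))
    ; Q-end        = λ i _ → trans (end-toℕPath (Q (clamp i)))
                               (trans (proj₁ (proj₂ (attached (clamp i)))) (≡-sym (at-toℕPath P _)))
    ; pu<pv        = λ i _ → proj₂ (proj₂ (attached (clamp i)))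
    ; Q-avoids-P   = λ i _ → InteriorAvoids-toℕPath (Q (clamp i)) P
                               (proj₁ (proj₂ (proj₂ (proj₂ (isPPath (clamp i))))))
    ; far-disjoint = λ i j j≤k 1+i<j →
                       let (avoids , avoided) = far (clamp i) (clamp j) (inj₁ (clamped-apart i j j≤k 1+i<j)) in
                       InteriorAvoids-toℕPath (Q (clamp i)) (Q (clamp j)) avoids ,
                       InteriorAvoids-toℕPath (Q (clamp j)) (Q (clamp i)) avoided
    ; Q-short      = λ i _ → short-without-∸ (proj₂ (proj₂ (attached (clamp i)))) (short (clamp i))
    ; pu₀≡0        = cong toℕ (trans (cong pu (clamp-toℕ zero)) pu₀≡0)
    ; pvₖ≡size     = trans (cong (λ x → toℕ (pv x)) clamp-k) (trans (cong toℕ pvₖ≡end) (toℕ-fromℕ (len P)))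
    ; staggered    = λ i i<k →
        subst₂ (λ a b → toℕ (pu a) < toℕ (pu b) × toℕ (pu b) < toℕ (pv a) × toℕ (pv a) < toℕ (pv b))
          (≡-sym (clamp-inject₁ i i<k)) (≡-sym (clamp-suc i i<k)) (staggered (fromℕ< i<k))
    ; P-within     = (λ i _ → inj₁ (clamp i , refl)) , (λ i i< → inj₁ (EdgeOf-toℕPath P i i<))
    ; Q-within     = λ i _ → (λ m _ → inj₂ (clamp i , clamp m , refl)) ,
                             (λ m m< → inj₂ (clamp i , EdgeOf-toℕPath (Q (clamp i)) m m<))
    }
    where
    clamped-apart : ∀ i j → j ≤ k → suc i < j → suc (toℕ (clamp {k} i)) < toℕ (clamp {k} j)
    clamped-apart i j j≤k 1+i<j = subst₂ (λ a b → suc a < b)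
      (≡-sym (toℕ-clamp i (≤-trans (≤-trans (n≤1+n i) (n≤1+n (suc i))) (≤-trans 1+i<j j≤k))))
      (≡-sym (toℕ-clamp j j≤k)) 1+i<j
    clamp-k : clamp k ≡ fromℕ k
    clamp-k = toℕ-injective (trans (toℕ-clamp k ≤-refl) (≡-sym (toℕ-fromℕ k)))

  conclude : ShortConnection P⁺ →
    Σ (Path G) λ R →
      ((start R ≡ start P × end R ≡ end P) ⊎ (start R ≡ end P × end R ≡ start P))
      × len R < ℓ
      × (∀ x → VertexOf R x → VertexOf P x ⊎ ∃ λ j → VertexOf (Q j) x)
      × (∀ x y → EdgeOf R x y → EdgeOf P x y ⊎ ∃ λ j → EdgeOf (Q j) x y)
  conclude (R , R-start , R-end , R-short , vertices-in , edges-in) =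
    fromℕPath R ,
    inj₁ (trans R-start (start-toℕPath P) ,
          trans (cong (at R) (toℕ-fromℕ (size R))) (trans R-end (end-toℕPath P))) ,
    R-short ,
    (λ x (i , eq) → subst InUnion eq (vertices-in (toℕ i) (≤-pred (toℕ<n i)))) ,
    edges
    where
    edge : ∀ (i : Fin (size R)) → EdgeInUnion (at R (toℕ (inject₁ i))) (at R (suc (toℕ i)))
    edge i = subst (λ z → EdgeInUnion (at R z) (at R (suc (toℕ i)))) (≡-sym (toℕ-inject₁ i))
               (edges-in (toℕ i) (toℕ<n i))
    flip : ∀ {x y} → EdgeInUnion x y → EdgeInUnion y x
    flip (inj₁ e)       = inj₁ (EdgeOf-sym P e)
    flip (inj₂ (j , e)) = inj₂ (j , EdgeOf-sym (Q j) e)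
    edges : ∀ x y → EdgeOf (fromℕPath R) x y → EdgeInUnion x y
    edges x y (i , inj₁ (x≡ , y≡)) = subst₂ EdgeInUnion x≡ y≡ (edge i)
    edges x y (i , inj₂ (y≡ , x≡)) = flip (subst₂ EdgeInUnion y≡ x≡ (edge i))

lemma4 : ∀ {n : ℕ} (G : Graph n) (ℓ : ℕ) → 1 ≤ ℓ →
    (P : Path G) (k : ℕ)
    (Q : Fin (suc k) → Path G)
    (pu pv : Fin (suc k) → Fin (suc (len P))) →
    (∀ i → IsPPath P (Q i)) →
    (∀ i → start (Q i) ≡ vtx P (pu i) × end (Q i) ≡ vtx P (pv i) × toℕ (pu i) < toℕ (pv i)) →
    (∀ i j → (suc (toℕ i) < toℕ j ⊎ suc (toℕ j) < toℕ i) → InternallyDisjoint (Q i) (Q j)) →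
    (∀ i → subpathCycleLength P (pu i) (pv i) (Q i) < ℓ) →
    pu zero ≡ zero → pv (fromℕ k) ≡ fromℕ (len P) →
    (∀ (i : Fin k) →
      toℕ (pu (inject₁ i)) < toℕ (pu (suc i))
      × toℕ (pu (suc i)) < toℕ (pv (inject₁ i))
      × toℕ (pv (inject₁ i)) < toℕ (pv (suc i))) →
    (∀ (C : Cycle G) → ℓ ≤ cycleLength C → 2 * ℓ ≤ cycleLength C) →
    Σ (Path G) λ R →
      ((start R ≡ start P × end R ≡ end P) ⊎ (start R ≡ end P × end R ≡ start P))
      × len R < ℓ
      × (∀ x → VertexOf R x → VertexOf P x ⊎ ∃ λ j → VertexOf (Q j) x)
      × (∀ x y → EdgeOf R x y → EdgeOf P x y ⊎ ∃ λ j → EdgeOf (Q j) x y)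
lemma4 G ℓ _ P k Q pu pv isPPath attached far short pu₀≡0 pvₖ≡end staggered long =
  conclude (shorten k (chain isPPath attached far short pu₀≡0 pvₖ≡end staggered))
  where open Embedding G ℓ long P Q pu pv
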